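{- Let $n\ge 2$ and let $D_n=\langle a,b\mid a^n=e,\ b^2=e,\ bab^{ -1}=a^{ -1}\rangle$. The chromatic number of the intersection hypergraph $\tilde{\Gamma}_\mathcal{H}(D_n)$ equals $2$.
   Context: For a group $G$, let $S$ be the set of all non-trivial proper subgroups of $G$. The intersection hypergraph $\tilde{\Gamma}_\mathcal{H}(G)$ has vertex set $V=\{H\in S \mid H\cap K=\{e\}\text{ for some }K\in S\}$, and a subset $E\subseteq V$ is a hyperedge iff any two distinct members of $E$ intersect trivially and $E$ is maximal among subsets of $V$ with this property. A proper vertex coloring of a hypergraph is an assignment of colors to vertices such that no hyperedge has all its vertices of the same color; the chromatic number is the minimum number of colors in a proper vertex coloring. -}

module Defs where

open import Data.Nat using (ℕ; zero; suc; _+_; _∸_; _≤_)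
open import Data.Nat.DivMod using (_mod_)
open import Data.Fin using (Fin; toℕ)
open import Data.Fin.Subset using (Subset; _∈_; _∉_)
open import Data.Product using (Σ; ∃; _×_; _,_)
open import Data.Empty using (⊥)
open import Relation.Nullary using (¬_)
open import Relation.Binary.PropositionalEquality using (_≡_; _≢_)

-- The dihedral group D_n = ⟨ a, b ∣ aⁿ = e, b² = e, b a b⁻¹ = a⁻¹ ⟩,
-- realised concretely on its 2n normal forms:
--   rot i  =  aⁱ      ref i  =  aⁱ b       (i ∈ ℤ/nℤ, represented by Fin n)

_⊕_ : {n : ℕ} → Fin n → Fin n → Fin n
_⊕_ {suc m} i j = (toℕ i + toℕ j) mod suc m

_⊖_ : {n : ℕ} → Fin n → Fin n → Fin n
_⊖_ {suc m} i j = (toℕ i + (suc m ∸ toℕ j)) mod suc m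

⊖_ : {n : ℕ} → Fin n → Fin n
⊖_ {suc m} i = (suc m ∸ toℕ i) mod suc m

data D (n : ℕ) : Set where
  rot : Fin n → D n
  ref : Fin n → D n

-- group law:  aⁱ aʲ = aⁱ⁺ʲ,  aⁱ (aʲ b) = aⁱ⁺ʲ b,  (aⁱ b) aʲ = aⁱ⁻ʲ b,
--             (aⁱ b)(aʲ b) = aⁱ⁻ʲ
_·_ : {n : ℕ} → D n → D n → D n
rot i · rot j = rot (i ⊕ j)
rot i · ref j = ref (i ⊕ j)
ref i · rot j = ref (i ⊖ j)
ref i · ref j = rot (i ⊖ j)

_⁻¹ : {n : ℕ} → D n → D n
rot i ⁻¹ = rot (⊖ i)
ref i ⁻¹ = ref i

IsId : {n : ℕ} → D n → Set
IsId (rot i) = toℕ i ≡ 0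
IsId (ref i) = ⊥

-- Subsets of D_n: a pair (set of rotation exponents, set of reflection
-- exponents).  Equality of subsets is structural equality.

Sub : ℕ → Set
Sub n = Subset n × Subset n

_∈D_ : {n : ℕ} → D n → Sub n → Set
rot i ∈D (R , F) = i ∈ R
ref i ∈D (R , F) = i ∈ F

IsSubgroup : {n : ℕ} → Sub n → Set
IsSubgroup {n} H =
  (∀ (x : D n) → IsId x → x ∈D H) ×
  (∀ (x y : D n) → x ∈D H → y ∈D H → (x · y) ∈D H) ×
  (∀ (x : D n) → x ∈D H → (x ⁻¹) ∈D H)

InS : {n : ℕ} → Sub n → Set
InS {n} H = IsSubgroup H
          × (∃ λ (x : D n) → x ∈D H × ¬ IsId x)
          × (∃ λ (x : D n) → ¬ (x ∈D H))

TrivInt : {n : ℕ} → Sub n → Sub n → Set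
TrivInt {n} H K = ∀ (x : D n) → x ∈D H → x ∈D K → IsId x

IsVertex : {n : ℕ} → Sub n → Set
IsVertex {n} H = InS H × (∃ λ (K : Sub n) → InS K × TrivInt H K)

IsHyperedge : {n : ℕ} → (Sub n → Set) → Set
IsHyperedge {n} E =
  (∀ H → E H → IsVertex H) ×
  (∀ H K → E H → E K → H ≢ K → TrivInt H K) ×
  (∀ H → IsVertex H → (∀ K → E K → H ≢ K → TrivInt H K) → E H)

IsProperColoring : {n k : ℕ} → (Sub n → Fin k) → Set₁
IsProperColoring {n} c =
  ∀ (E : Sub n → Set) → IsHyperedge E →
    ¬ (∀ H K → E H → E K → c H ≡ c K)

Colorable : ℕ → ℕ → Set₁
Colorable n k = Σ (Sub n → Fin k) IsProperColoring

IsChromaticNumber : ℕ → ℕ → Set₁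
IsChromaticNumber n k = Colorable n k × (∀ j → Colorable n j → k ≤ j)

-- Colour a subgroup by whether it contains the reflection b.  Subgroups
-- containing b pairwise meet non-trivially, so a hyperedge all of whose
-- members contain b has at most one member K, and maximality then forces in
-- a partner of K meeting it trivially, which cannot contain b; a hyperedge
-- with no member containing b is extended by ⟨b⟩.  One colour does not
-- suffice because ⟨a⟩ and all the ⟨aⁱb⟩ form a hyperedge.
module Submission where

open import Defs
open import Data.Nat using (ℕ; zero; suc; _+_; _∸_; _%_; _≤_; z≤n; s≤s)
open import Data.Nat.Properties using (m∸n+n≡m; m+[n∸m]≡n; <⇒≤; +-assoc)
open import Data.Nat.DivMod using (_mod_; m<n⇒m%n≡m; [m+n]%n≡m%n; n%n≡0; m%n%n≡m%n; %-distribˡ-+)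
open import Data.Fin as Fin using (Fin; toℕ)
open import Data.Fin.Properties using (toℕ-injective; toℕ<n; toℕ-fromℕ<)
open import Data.Fin.Subset using (_∈_; ⊤; ⊥; ⁅_⁆; _⊆_)
open import Data.Fin.Subset.Properties using (_∈?_; ∈⊤; ∉⊥; x∈⁅x⁆; x∈⁅y⁆⇒x≡y; x∈⁅y⁆⇔x≡y; x≢y⇒x∉⁅y⁆; ⊆-antisym)
open import Data.Product using (Σ; ∃; _,_)
open import Data.Sum using (_⊎_; inj₁; inj₂)
open import Data.Empty using (⊥-elim)
open import Data.Bool using (if_then_else_)
import Data.Bool.Properties as Bool
import Data.Vec.Properties as Vec
import Data.Product.Properties as Product
open import Function using (_∘_; Equivalence)
open import Relation.Nullary using (¬_; Dec; yes; no; does)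
open import Relation.Binary.Definitions using (DecidableEquality)
open import Relation.Binary.PropositionalEquality
open ≡-Reasoning

module _ {n : ℕ} where

  _≟ˢ_ : DecidableEquality (Sub n)
  _≟ˢ_ = Product.≡-dec (Vec.≡-dec Bool._≟_) (Vec.≡-dec Bool._≟_)

  _∈D?_ : (x : D n) (H : Sub n) → Dec (x ∈D H)
  rot i ∈D? (R , F) = i ∈? R
  ref i ∈D? (R , F) = i ∈? F

  trivInt-sym : {H K : Sub n} → TrivInt H K → TrivInt K H
  trivInt-sym H∩K x x∈K x∈H = H∩K x x∈H x∈K

  Intersecting : (Sub n → Set) → Set
  Intersecting P = ∀ H K → P H → P K → ¬ TrivInt H K

  containing-intersecting : {x : D n} → ¬ IsId x → Intersecting (x ∈D_)
  containing-intersecting x≢e H K x∈H x∈K H∩K = x≢e (H∩K _ x∈H x∈K)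

  -- A member K would force the partner L witnessing that K is a vertex into
  -- the hyperedge: K is the only member L could fail to meet trivially.
  hyperedge⊆intersecting⇒empty : {E P : Sub n → Set} → IsHyperedge E → Intersecting P →
                                 (∀ H → E H → P H) → ∀ K → ¬ E K
  hyperedge⊆intersecting⇒empty {E} (vertex , pairwise , maximal) intersecting E⊆P K K∈E
    with vertex K K∈E
  ... | K∈S , L , L∈S , K∩L = intersecting K L (E⊆P K K∈E) (E⊆P L L∈E) K∩L
    where
      L∩member : ∀ M → E M → Dec (M ≡ K) → TrivInt L M
      L∩member M M∈E (yes refl) = trivInt-sym K∩L
      L∩member M M∈E (no M≢K)   =
        ⊥-elim (intersecting K M (E⊆P K K∈E) (E⊆P M M∈E) (pairwise K M K∈E M∈E (M≢K ∘ sym)))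

      L∈E : E L
      L∈E = maximal L (L∈S , K , K∈S , trivInt-sym K∩L) λ M M∈E _ → L∩member M M∈E (M ≟ˢ K)

  membershipColouring : D n → Sub n → Fin 2
  membershipColouring x H = if does (x ∈D? H) then Fin.suc Fin.zero else Fin.zero

  membershipColouring-reflects : ∀ x H K → membershipColouring x H ≡ membershipColouring x K →
                                 x ∈D K → x ∈D H
  membershipColouring-reflects x H K _ x∈K with x ∈D? H | x ∈D? K
  ... | yes x∈H | _      = x∈H
  ... | no _    | no x∉K = ⊥-elim (x∉K x∈K)
  membershipColouring-reflects x H K () x∈K | no _ | yes _

  membershipColouring-proper : {x : D n} {B : Sub n} → ¬ IsId x → IsVertex B → x ∈D B →
                               (∀ K → ¬ x ∈D K → TrivInt B K) →
                               IsProperColoring (membershipColouring x)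
  membershipColouring-proper {x} {B} x≢e B-vertex x∈B B∩avoiding
                             E E-hyperedge@(_ , _ , maximal) monochrome = x∉member B B∈E x∈B
    where
      x∉member : ∀ K → E K → ¬ x ∈D K
      x∉member K K∈E x∈K =
        hyperedge⊆intersecting⇒empty E-hyperedge (containing-intersecting x≢e)
          (λ H H∈E → membershipColouring-reflects x H K (monochrome H K H∈E K∈E) x∈K) K K∈E

      B∈E : E B
      B∈E = maximal B B-vertex λ K K∈E _ → B∩avoiding K (x∉member K K∈E)

  hyperedge⇒2≤colours : Σ (Sub n → Set) IsHyperedge → ∀ k → Colorable n k → 2 ≤ k
  hyperedge⇒2≤colours _ zero (c , _) with c (⊥ , ⊥)
  ... | ()
  hyperedge⇒2≤colours (E , E-hyperedge) (suc zero) (c , proper) =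
    ⊥-elim (proper E E-hyperedge λ H K _ _ → Fin1-≡ (c H) (c K))
    where
      Fin1-≡ : (i j : Fin 1) → i ≡ j
      Fin1-≡ Fin.zero Fin.zero = refl
  hyperedge⇒2≤colours _ (suc (suc k)) _ = s≤s (s≤s z≤n)

rotations : {n : ℕ} → Sub n
rotations = ⊤ , ⊥

rotations-isSubgroup : {n : ℕ} → IsSubgroup (rotations {n})
rotations-isSubgroup = has-e , closed , inverses
  where
    has-e : ∀ x → IsId x → x ∈D rotations
    has-e (rot i) _ = ∈⊤

    closed : ∀ x y → x ∈D rotations → y ∈D rotations → (x · y) ∈D rotations
    closed (rot i) (rot j) _ _   = ∈⊤
    closed (rot i) (ref j) _ j∈⊥ = ⊥-elim (∉⊥ j∈⊥)
    closed (ref i) _ i∈⊥ _       = ⊥-elim (∉⊥ i∈⊥)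

    inverses : ∀ x → x ∈D rotations → (x ⁻¹) ∈D rotations
    inverses (rot i) _   = ∈⊤
    inverses (ref i) i∈⊥ = ⊥-elim (∉⊥ i∈⊥)

module _ {m : ℕ} where

  private
    N : ℕ
    N = suc m

  toℕ-mod : ∀ a → toℕ (a mod N) ≡ a % N
  toℕ-mod a = toℕ-fromℕ< _

  %≡toℕ⇒mod≡ : ∀ a {i : Fin N} → a % N ≡ toℕ i → a mod N ≡ i
  %≡toℕ⇒mod≡ a p = toℕ-injective (trans (toℕ-mod a) p)

  ⊕-identityˡ : (i : Fin N) → Fin.zero ⊕ i ≡ i
  ⊕-identityˡ i = %≡toℕ⇒mod≡ (toℕ i) (m<n⇒m%n≡m (toℕ<n i))

  ⊖-identityʳ : (i : Fin N) → i ⊖ Fin.zero ≡ i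
  ⊖-identityʳ i = %≡toℕ⇒mod≡ (toℕ i + N) (trans ([m+n]%n≡m%n (toℕ i) N) (m<n⇒m%n≡m (toℕ<n i)))

  ⊖-self : (i : Fin N) → i ⊖ i ≡ Fin.zero
  ⊖-self i = %≡toℕ⇒mod≡ (toℕ i + (N ∸ toℕ i))
    (trans (cong (_% N) (m+[n∸m]≡n (<⇒≤ (toℕ<n i)))) (n%n≡0 N))

  ⊖-zero : ⊖_ {N} Fin.zero ≡ Fin.zero
  ⊖-zero = %≡toℕ⇒mod≡ N (n%n≡0 N)

  [m%n+k]%n≡[m+k]%n : ∀ a b → (a % N + b) % N ≡ (a + b) % N
  [m%n+k]%n≡[m+k]%n a b = begin
    (a % N + b) % N          ≡⟨ %-distribˡ-+ (a % N) b N ⟩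
    (a % N % N + b % N) % N  ≡⟨ cong (λ r → (r + b % N) % N) (m%n%n≡m%n a N) ⟩
    (a % N + b % N) % N      ≡⟨ %-distribˡ-+ a b N ⟨
    (a + b) % N              ∎

  ⊖-⊕-cancel : (i j : Fin N) → (i ⊖ j) ⊕ j ≡ i
  ⊖-⊕-cancel i j = %≡toℕ⇒mod≡ (toℕ (i ⊖ j) + b) (begin
    (toℕ (i ⊖ j) + b) % N      ≡⟨ cong (λ r → (r + b) % N) (toℕ-mod (a + (N ∸ b))) ⟩
    ((a + (N ∸ b)) % N + b) % N ≡⟨ [m%n+k]%n≡[m+k]%n (a + (N ∸ b)) b ⟩
    (a + (N ∸ b) + b) % N      ≡⟨ cong (_% N) (+-assoc a (N ∸ b) b) ⟩
    (a + (N ∸ b + b)) % N      ≡⟨ cong (λ r → (a + r) % N) (m∸n+n≡m (<⇒≤ (toℕ<n j))) ⟩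
    (a + N) % N                ≡⟨ [m+n]%n≡m%n a N ⟩
    a % N                      ≡⟨ m<n⇒m%n≡m (toℕ<n i) ⟩
    a                          ∎)
    where
      a = toℕ i
      b = toℕ j

  ⊖≡zero⇒≡ : {i j : Fin N} → i ⊖ j ≡ Fin.zero → i ≡ j
  ⊖≡zero⇒≡ {i} {j} i⊖j≡0 = begin
    i              ≡⟨ ⊖-⊕-cancel i j ⟨
    (i ⊖ j) ⊕ j    ≡⟨ cong (_⊕ j) i⊖j≡0 ⟩
    Fin.zero ⊕ j   ≡⟨ ⊕-identityˡ j ⟩
    j              ∎

  x≡y⇒x∈⁅y⁆ : {i j : Fin N} → i ≡ j → i ∈ ⁅ j ⁆
  x≡y⇒x∈⁅y⁆ = Equivalence.from x∈⁅y⁆⇔x≡y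

  ⟨ref_⟩ : Fin N → Sub N
  ⟨ref i ⟩ = ⁅ Fin.zero ⁆ , ⁅ i ⁆

  ⟨ref⟩-isSubgroup : (i : Fin N) → IsSubgroup ⟨ref i ⟩
  ⟨ref⟩-isSubgroup i = has-e , closed , inverses
    where
      has-e : ∀ x → IsId x → x ∈D ⟨ref i ⟩
      has-e (rot j) j≡0 = x≡y⇒x∈⁅y⁆ (toℕ-injective j≡0)

      closed : ∀ x y → x ∈D ⟨ref i ⟩ → y ∈D ⟨ref i ⟩ → (x · y) ∈D ⟨ref i ⟩
      closed (rot j) (rot k) j∈ k∈ =
        x≡y⇒x∈⁅y⁆ (cong₂ _⊕_ (x∈⁅y⁆⇒x≡y Fin.zero j∈) (x∈⁅y⁆⇒x≡y Fin.zero k∈))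
      closed (rot j) (ref k) j∈ k∈ =
        x≡y⇒x∈⁅y⁆ (trans (cong₂ _⊕_ (x∈⁅y⁆⇒x≡y Fin.zero j∈) (x∈⁅y⁆⇒x≡y i k∈)) (⊕-identityˡ i))
      closed (ref j) (rot k) j∈ k∈ =
        x≡y⇒x∈⁅y⁆ (trans (cong₂ _⊖_ (x∈⁅y⁆⇒x≡y i j∈) (x∈⁅y⁆⇒x≡y Fin.zero k∈)) (⊖-identityʳ i))
      closed (ref j) (ref k) j∈ k∈ =
        x≡y⇒x∈⁅y⁆ (trans (cong₂ _⊖_ (x∈⁅y⁆⇒x≡y i j∈) (x∈⁅y⁆⇒x≡y i k∈)) (⊖-self i))

      inverses : ∀ x → x ∈D ⟨ref i ⟩ → (x ⁻¹) ∈D ⟨ref i ⟩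
      inverses (rot j) j∈ = x≡y⇒x∈⁅y⁆ (trans (cong ⊖_ (x∈⁅y⁆⇒x≡y Fin.zero j∈)) ⊖-zero)
      inverses (ref j) j∈ = j∈

  ⟨ref⟩-trivInt-avoiding : ∀ i K → ¬ ref i ∈D K → TrivInt ⟨ref i ⟩ K
  ⟨ref⟩-trivInt-avoiding i K _   (rot j) j∈ _   = cong toℕ (x∈⁅y⁆⇒x≡y Fin.zero j∈)
  ⟨ref⟩-trivInt-avoiding i K i∉K (ref j) j∈ j∈K =
    ⊥-elim (i∉K (subst (λ k → ref k ∈D K) (x∈⁅y⁆⇒x≡y i j∈) j∈K))

  ⟨ref⟩-trivInt-rotations : ∀ i → TrivInt ⟨ref i ⟩ rotations
  ⟨ref⟩-trivInt-rotations i = ⟨ref⟩-trivInt-avoiding i rotations ∉⊥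

  -- ref i · ref j = rot (i ⊖ j) lies in H ∩ rotations, which forces j = i.
  trivInt-rotations⇒≡⟨ref⟩ : {H : Sub N} {i : Fin N} → IsSubgroup H → TrivInt H rotations →
                             ref i ∈D H → H ≡ ⟨ref i ⟩
  trivInt-rotations⇒≡⟨ref⟩ {R , F} {i} (has-e , closed , _) H∩rotations i∈F =
    cong₂ _,_ (⊆-antisym R⊆ ⊆R) (⊆-antisym F⊆ ⊆F)
    where
      rot∈H⇒≡zero : ∀ {j} → j ∈ R → j ≡ Fin.zero
      rot∈H⇒≡zero j∈R = toℕ-injective (H∩rotations (rot _) j∈R ∈⊤)

      R⊆ : R ⊆ ⁅ Fin.zero ⁆
      R⊆ j∈R = x≡y⇒x∈⁅y⁆ (rot∈H⇒≡zero j∈R)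

      ⊆R : ⁅ Fin.zero ⁆ ⊆ R
      ⊆R j∈ = has-e (rot _) (cong toℕ (x∈⁅y⁆⇒x≡y Fin.zero j∈))

      F⊆ : F ⊆ ⁅ i ⁆
      F⊆ {j} j∈F = x≡y⇒x∈⁅y⁆ (sym (⊖≡zero⇒≡ (rot∈H⇒≡zero (closed (ref i) (ref j) i∈F j∈F))))

      ⊆F : ⁅ i ⁆ ⊆ F
      ⊆F j∈ rewrite x∈⁅y⁆⇒x≡y i j∈ = i∈F

module _ {m : ℕ} where

  private
    N : ℕ
    N = suc (suc m)

    a : Fin N
    a = Fin.suc Fin.zero

  rotations-inS : InS (rotations {N})
  rotations-inS = rotations-isSubgroup , (rot a , ∈⊤ , λ ()) , (ref Fin.zero , ∉⊥)

  ⟨ref⟩-inS : (i : Fin N) → InS ⟨ref i ⟩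
  ⟨ref⟩-inS i = ⟨ref⟩-isSubgroup i , (ref i , x∈⁅x⁆ i , λ ()) , (rot a , x≢y⇒x∉⁅y⁆ {y = Fin.zero} λ ())

  rotations-isVertex : IsVertex (rotations {N})
  rotations-isVertex =
    rotations-inS , ⟨ref Fin.zero ⟩ , ⟨ref⟩-inS Fin.zero , trivInt-sym (⟨ref⟩-trivInt-rotations Fin.zero)

  ⟨ref⟩-isVertex : (i : Fin N) → IsVertex ⟨ref i ⟩
  ⟨ref⟩-isVertex i = ⟨ref⟩-inS i , rotations , rotations-inS , ⟨ref⟩-trivInt-rotations i

  RotationsOrReflection : Sub N → Set
  RotationsOrReflection H = H ≡ rotations ⊎ ∃ λ i → H ≡ ⟨ref i ⟩

  rotationsOrReflection-isHyperedge : IsHyperedge RotationsOrReflection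
  rotationsOrReflection-isHyperedge = vertex , pairwise , maximal
    where
      vertex : ∀ H → RotationsOrReflection H → IsVertex H
      vertex _ (inj₁ refl)       = rotations-isVertex
      vertex _ (inj₂ (i , refl)) = ⟨ref⟩-isVertex i

      pairwise : ∀ H K → RotationsOrReflection H → RotationsOrReflection K → H ≢ K → TrivInt H K
      pairwise _ _ (inj₁ refl)       (inj₁ refl)       H≢K = ⊥-elim (H≢K refl)
      pairwise _ _ (inj₁ refl)       (inj₂ (i , refl)) _   = trivInt-sym (⟨ref⟩-trivInt-rotations i)
      pairwise _ _ (inj₂ (i , refl)) (inj₁ refl)       _   = ⟨ref⟩-trivInt-rotations i
      pairwise _ _ (inj₂ (i , refl)) (inj₂ (j , refl)) H≢K =
        ⟨ref⟩-trivInt-avoiding i ⟨ref j ⟩ (x≢y⇒x∉⁅y⁆ (H≢K ∘ cong ⟨ref_⟩))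

      maximal : ∀ H → IsVertex H → (∀ K → RotationsOrReflection K → H ≢ K → TrivInt H K) →
                RotationsOrReflection H
      maximal H _ _ with H ≟ˢ rotations
      ... | yes H≡rotations = inj₁ H≡rotations
      maximal H ((H-subgroup , (x , x∈H , x≢e) , _) , _) H∩members | no H≢rotations =
        reflection x x∈H x≢e
        where
          H∩rotations : TrivInt H rotations
          H∩rotations = H∩members rotations (inj₁ refl) H≢rotations

          reflection : ∀ x → x ∈D H → ¬ IsId x → RotationsOrReflection H
          reflection (rot j) j∈H j≢0 = ⊥-elim (j≢0 (H∩rotations (rot j) j∈H ∈⊤))
          reflection (ref i) i∈H _   = inj₂ (i , trivInt-rotations⇒≡⟨ref⟩ H-subgroup H∩rotations i∈H)

mainTheorem8 : ∀ (n : ℕ) → 2 ≤ n → IsChromaticNumber n 2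
mainTheorem8 1 (s≤s ())
mainTheorem8 (suc (suc m)) _ =
  ( membershipColouring b
  , membershipColouring-proper {x = b} (λ ()) (⟨ref⟩-isVertex Fin.zero) (x∈⁅x⁆ Fin.zero)
      (⟨ref⟩-trivInt-avoiding Fin.zero))
  , hyperedge⇒2≤colours (RotationsOrReflection , rotationsOrReflection-isHyperedge)
  where
    b : D (suc (suc m))
    b = ref Fin.zero
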